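{- Let $n>m\ge 2$ and let $\vec K$ be any orientation of $K_{m,n}$. If there exist two distinct vertices $u,v$ of $\vec K$ that are full twins in $\vec K$, then $\vec K$ is not rigid. In particular, if $n>2^m$, then $K_{m,n}$ does not admit any rigid orientation.
   Context: $K_{m,n}$ is the complete bipartite graph with parts of sizes $m$ and $n$. An orientation assigns one direction to each edge. For a vertex $u$ of an oriented graph, $N^+(u)$ is its set of out-neighbours. Two vertices $u,v$ are full twins if $N^+(u)=N^+(v)$. An automorphism of an oriented graph is a permutation $\phi$ of its vertices such that $\phi(u)\phi(v)$ is an arc whenever $uv$ is an arc; the oriented graph is rigid if its only automorphism is the identity. -}

module Defs where

open import Data.Nat using (ℕ)
open import Data.Fin using (Fin)
open import Data.Bool using (Bool; true; false)
open import Data.Sum using (_⊎_; inj₁; inj₂)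
open import Data.Empty using (⊥)
open import Data.Unit using (⊤)
open import Relation.Binary.PropositionalEquality using (_≡_)
open import Function.Bundles using (_↔_; Inverse)
open import Function.Base using (_∘_)
open import Level using (0ℓ)

Vertex : ℕ → ℕ → Set
Vertex m n = Fin m ⊎ Fin n

-- An orientation of K_{m,n}: for each edge {a,b} (a in the m-part, b in the
-- n-part), true means the arc a → b, false means the arc b → a.
Orientation : ℕ → ℕ → Set
Orientation m n = Fin m → Fin n → Bool

Arc : ∀ {m n} → Orientation m n → Vertex m n → Vertex m n → Set
Arc o (inj₁ a) (inj₁ a′) = ⊥
Arc o (inj₂ b) (inj₂ b′) = ⊥
Arc o (inj₁ a) (inj₂ b) = o a b ≡ true
Arc o (inj₂ b) (inj₁ a) = o a b ≡ false

FullTwins : ∀ {m n} → Orientation m n → Vertex m n → Vertex m n → Set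
FullTwins o u v = ∀ w → (Arc o u w → Arc o v w) × (Arc o v w → Arc o u w)
  where open import Data.Product using (_×_)

record Automorphism {m n} (o : Orientation m n) : Set where
  field
    perm     : Vertex m n ↔ Vertex m n
    preserve : ∀ u v → Arc o u v →
               Arc o (Inverse.to perm u) (Inverse.to perm v)

Rigid : ∀ {m n} → Orientation m n → Set
Rigid o = (φ : Automorphism o) → ∀ u → Inverse.to (Automorphism.perm φ) u ≡ u

module Submission where

-- Proof idea.  An orientation o of K_{m,n} is a Boolean m×n matrix: row a
-- lists the arcs at the vertex a of the small part, column b those at the
-- vertex b of the large part.
--
-- 1. Relabelling the two parts by permutations π, σ that leave the matrix
--    unchanged (o (π a) (σ b) = o a b) is an automorphism; an automorphism
--    moving some vertex witnesses that o is not rigid.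
-- 2. Hence two distinct equal rows (or two distinct equal columns) make o
--    non-rigid: transpose them.
-- 3. Full twins always give such a pair: twins cannot lie in different parts
--    (an arc between them would be an out-arc of one but not the other), and
--    twins in the same part have equal rows resp. columns, since in K_{m,n}
--    knowing the out-neighbourhood determines every incident arc.
-- 4. If n > 2^m, the n columns are elements of the 2^m-element set Bool^m, so
--    by pigeonhole two distinct columns coincide, and step 2 applies.

open import Defs
open import Data.Nat using (ℕ; _<_; _≤_; _^_)
open import Data.Product using (_×_; _,_; proj₁; proj₂; ∃₂)
open import Data.Sum using (inj₁; inj₂)
open import Data.Sum.Properties using (inj₁-injective; inj₂-injective)
open import Data.Bool using (Bool; true; false)
open import Data.Empty using (⊥)
open import Data.Fin using (Fin; funToFin; finToFun)
open import Data.Fin.Properties using (_≟_; pigeonhole; <⇒≢; finToFun-funToFin; 2↔Bool)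
open import Data.Fin.Permutation using (Permutation; _⟨$⟩ʳ_; transpose)
import Data.Fin.Permutation as Perm
open import Data.Sum.Function.Propositional using (_⊎-↔_)
open import Function.Bundles using (Inverse)
open import Relation.Nullary using (¬_; yes; no; contradiction)
open import Relation.Binary.PropositionalEquality
  using (_≡_; _≢_; refl; sym; trans; cong; module ≡-Reasoning)

moving-automorphism⇒¬rigid : ∀ {m n} {o : Orientation m n} (φ : Automorphism o) u →
  Inverse.to (Automorphism.perm φ) u ≢ u → ¬ Rigid o
moving-automorphism⇒¬rigid φ u moved rigid = moved (rigid φ u)

partwise-automorphism : ∀ {m n} (o : Orientation m n)
  (π : Permutation m m) (σ : Permutation n n) →
  (∀ a b → o (π ⟨$⟩ʳ a) (σ ⟨$⟩ʳ b) ≡ o a b) → Automorphism o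
partwise-automorphism o π σ invariant = record
  { perm     = π ⊎-↔ σ
  ; preserve = preserve
  }
  where
  preserve : ∀ u v → Arc o u v →
             Arc o (Inverse.to (π ⊎-↔ σ) u) (Inverse.to (π ⊎-↔ σ) v)
  preserve (inj₁ a) (inj₂ b) a→b = trans (invariant a b) a→b
  preserve (inj₂ b) (inj₁ a) b→a = trans (invariant a b) b→a

transpose-invariant : ∀ {k} {X : Set} (f : Fin k → X) {i j : Fin k} →
  f i ≡ f j → ∀ x → f (transpose i j ⟨$⟩ʳ x) ≡ f x
transpose-invariant f {i} {j} fi≡fj x with x ≟ i
... | yes refl = sym fi≡fj
... | no _ with x ≟ j
...   | yes refl = fi≡fj
...   | no _     = refl

transpose-sends : ∀ {k} (i j : Fin k) → transpose i j ⟨$⟩ʳ i ≡ j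
transpose-sends i j with i ≟ i
... | yes _  = refl
... | no i≢i = contradiction refl i≢i

equal-rows⇒¬rigid : ∀ {m n} (o : Orientation m n) {a a′ : Fin m} → a ≢ a′ →
  (∀ b → o a b ≡ o a′ b) → ¬ Rigid o
equal-rows⇒¬rigid o {a} {a′} a≢a′ same-row =
  moving-automorphism⇒¬rigid swap (inj₁ a) moved
  where
  swap : Automorphism o
  swap = partwise-automorphism o (transpose a a′) Perm.id
           (λ a″ b → transpose-invariant (λ x → o x b) (same-row b) a″)
  moved : inj₁ (transpose a a′ ⟨$⟩ʳ a) ≢ inj₁ a
  moved eq = a≢a′ (trans (sym (inj₁-injective eq)) (transpose-sends a a′))

equal-columns⇒¬rigid : ∀ {m n} (o : Orientation m n) {b b′ : Fin n} → b ≢ b′ →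
  (∀ a → o a b ≡ o a b′) → ¬ Rigid o
equal-columns⇒¬rigid o {b} {b′} b≢b′ same-column =
  moving-automorphism⇒¬rigid swap (inj₂ b) moved
  where
  swap : Automorphism o
  swap = partwise-automorphism o Perm.id (transpose b b′)
           (λ a b″ → transpose-invariant (o a) (same-column a) b″)
  moved : inj₂ (transpose b b′ ⟨$⟩ʳ b) ≢ inj₂ b
  moved eq = b≢b′ (trans (sym (inj₂-injective eq)) (transpose-sends b b′))

agree-at⇒≡ : ∀ c {x y : Bool} → (x ≡ c → y ≡ c) → (y ≡ c → x ≡ c) → x ≡ y
agree-at⇒≡ c     {true}  {true}  _ _ = refl
agree-at⇒≡ c     {false} {false} _ _ = refl
agree-at⇒≡ true  {true}  {false} x→y _ with x→y refl
... | ()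
agree-at⇒≡ false {true}  {false} _ y→x with y→x refl
... | ()
agree-at⇒≡ true  {false} {true}  _ y→x with y→x refl
... | ()
agree-at⇒≡ false {false} {true}  x→y _ with x→y refl
... | ()

twins₁⇒equal-rows : ∀ {m n} (o : Orientation m n) {a a′ : Fin m} →
  FullTwins o (inj₁ a) (inj₁ a′) → ∀ b → o a b ≡ o a′ b
twins₁⇒equal-rows o twins b = agree-at⇒≡ true (proj₁ (twins (inj₂ b))) (proj₂ (twins (inj₂ b)))

twins₂⇒equal-columns : ∀ {m n} (o : Orientation m n) {b b′ : Fin n} →
  FullTwins o (inj₂ b) (inj₂ b′) → ∀ a → o a b ≡ o a b′
twins₂⇒equal-columns o twins a = agree-at⇒≡ false (proj₁ (twins (inj₁ a))) (proj₂ (twins (inj₁ a)))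

-- Vertices of different parts are never full twins: the arc between them
-- leaves one of them but cannot leave the other.
twins-across-parts : ∀ {m n} (o : Orientation m n) (a : Fin m) (b : Fin n) →
  ¬ FullTwins o (inj₁ a) (inj₂ b)
twins-across-parts o a b twins = via (o a b) refl
  where
  via : ∀ x → o a b ≡ x → ⊥
  via true  a→b = proj₁ (twins (inj₂ b)) a→b
  via false b→a = proj₂ (twins (inj₁ a)) b→a

FullTwins-sym : ∀ {m n} (o : Orientation m n) {u v : Vertex m n} →
  FullTwins o u v → FullTwins o v u
FullTwins-sym o twins w = proj₂ (twins w) , proj₁ (twins w)

twins⇒¬rigid : ∀ {m n} (o : Orientation m n) (u v : Vertex m n) → u ≢ v →
  FullTwins o u v → ¬ Rigid o
twins⇒¬rigid o (inj₁ a) (inj₁ a′) u≢v twins =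
  equal-rows⇒¬rigid o (λ a≡a′ → u≢v (cong inj₁ a≡a′)) (twins₁⇒equal-rows o twins)
twins⇒¬rigid o (inj₂ b) (inj₂ b′) u≢v twins =
  equal-columns⇒¬rigid o (λ b≡b′ → u≢v (cong inj₂ b≡b′)) (twins₂⇒equal-columns o twins)
twins⇒¬rigid o (inj₁ a) (inj₂ b) _ twins _ = twins-across-parts o a b twins
twins⇒¬rigid o (inj₂ b) (inj₁ a) _ twins _ = twins-across-parts o a b (FullTwins-sym o twins)

funToFin-injective : ∀ {m k} (f g : Fin m → Fin k) →
  funToFin f ≡ funToFin g → ∀ i → f i ≡ g i
funToFin-injective f g code≡ i = begin
  f i                      ≡⟨ sym (finToFun-funToFin f i) ⟩
  finToFun (funToFin f) i  ≡⟨ cong (λ c → finToFun c i) code≡ ⟩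
  finToFun (funToFin g) i  ≡⟨ finToFun-funToFin g i ⟩
  g i                      ∎
  where open ≡-Reasoning

column-code : ∀ {m n} → Orientation m n → Fin n → Fin (2 ^ m)
column-code o b = funToFin (λ a → Inverse.from 2↔Bool (o a b))

column-code-injective : ∀ {m n} (o : Orientation m n) {b b′ : Fin n} →
  column-code o b ≡ column-code o b′ → ∀ a → o a b ≡ o a b′
column-code-injective o {b} {b′} code≡ a = begin
  o a b                    ≡⟨ sym (strictlyInverseˡ (o a b)) ⟩
  to (from (o a b))        ≡⟨ cong to (funToFin-injective _ _ code≡ a) ⟩
  to (from (o a b′))       ≡⟨ strictlyInverseˡ (o a b′) ⟩
  o a b′                   ∎
  where
  open ≡-Reasoning
  open Inverse 2↔Bool using (to; from; strictlyInverseˡ)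

repeated-column : ∀ {m n} → 2 ^ m < n → (o : Orientation m n) →
  ∃₂ λ b b′ → b ≢ b′ × (∀ a → o a b ≡ o a b′)
repeated-column n>2^m o with pigeonhole n>2^m (column-code o)
... | b , b′ , b<b′ , code≡ = b , b′ , <⇒≢ b<b′ , column-code-injective o code≡

proposition16 : (m n : ℕ) → 2 ≤ m → m < n →
    ((o : Orientation m n) → (u v : Vertex m n) → u ≢ v →
      FullTwins o u v → ¬ Rigid o)
    × (2 ^ m < n → (o : Orientation m n) → ¬ Rigid o)
proposition16 m n _ _ = twins⇒¬rigid , many-columns⇒¬rigid
  where
  many-columns⇒¬rigid : 2 ^ m < n → (o : Orientation m n) → ¬ Rigid o
  many-columns⇒¬rigid n>2^m o with repeated-column n>2^m o
  ... | b , b′ , b≢b′ , same-column = equal-columns⇒¬rigid o b≢b′ same-column
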